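{- Every co-interval graph of girth at least five is a forest in which each connected component has diameter at most $3$. On the other hand, every tree of diameter at most $3$ is a co-interval graph.
   Context: All graphs are finite and simple. An interval graph is a graph admitting a representation by real intervals (each either a bounded interval of $\mathbb{R}$ or $\mathbb{R}$ itself), one per vertex, where distinct vertices are adjacent iff their intervals intersect. A co-interval graph is the complement of an interval graph. The girth of a graph is the length of a shortest cycle (infinite if acyclic).
   Formalization: Interval representations use intervals of the rational line, with rational endpoints, in place of real intervals that are bounded or equal to ℝ. -}

module Defs where

open import Data.Bool using (Bool; true; false; not; if_then_else_)
open import Data.Nat using (ℕ; zero; suc; _≤_)
open import Data.Fin using (Fin; zero; suc; inject₁; fromℕ; _≟_)
open import Data.Rational using (ℚ) renaming (_≤_ to _≤ℚ_; _<_ to _<ℚ_)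
open import Data.Product using (Σ; ∃; _×_; _,_)
open import Data.Unit using (⊤)
open import Relation.Nullary using (¬_; does)
open import Relation.Binary.PropositionalEquality using (_≡_; _≢_; refl)
open import Function.Bundles using (_⇔_)
open import Function.Definitions using (Injective)

record Graph (n : ℕ) : Set where
  field
    adj    : Fin n → Fin n → Bool
    sym    : ∀ u v → adj u v ≡ adj v u
    irrefl : ∀ v → adj v v ≡ false
open Graph public

Adj : ∀ {n} → Graph n → Fin n → Fin n → Set
Adj G u v = adj G u v ≡ true

private
  coAdj : ∀ {n} → Graph n → Fin n → Fin n → Bool
  coAdj G u v = if does (u ≟ v) then false else not (adj G u v)

  ≟-sym : ∀ {n} (u v : Fin n) → does (u ≟ v) ≡ does (v ≟ u)
  ≟-sym u v with u ≟ v | v ≟ u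
  ... | Relation.Nullary.yes _ | Relation.Nullary.yes _ = refl
  ... | Relation.Nullary.no _  | Relation.Nullary.no _  = refl
  ... | Relation.Nullary.yes refl | Relation.Nullary.no q = Data.Empty.⊥-elim (q refl)
    where import Data.Empty
  ... | Relation.Nullary.no p  | Relation.Nullary.yes refl = Data.Empty.⊥-elim (p refl)
    where import Data.Empty

  coSym : ∀ {n} (G : Graph n) u v → coAdj G u v ≡ coAdj G v u
  coSym G u v rewrite ≟-sym u v | sym G u v = refl

  coIrr : ∀ {n} (G : Graph n) v → coAdj G v v ≡ false
  coIrr G v with v ≟ v
  ... | Relation.Nullary.yes _ = refl
  ... | Relation.Nullary.no p = Data.Empty.⊥-elim (p refl)
    where import Data.Empty

complement : ∀ {n} → Graph n → Graph n
complement G = record { adj = coAdj G ; sym = coSym G ; irrefl = coIrr G }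

-- Intervals of the line (over ℚ)
-- `bounded a b lc rc` : interval with endpoints a, b; lc/rc say whether
-- the left/right endpoint is included.  `whole` is the entire line.

data Interval : Set where
  whole   : Interval
  bounded : (a b : ℚ) (lc rc : Bool) → Interval

_∈I_ : ℚ → Interval → Set
x ∈I whole = ⊤
x ∈I bounded a b lc rc =
  (if lc then a ≤ℚ x else a <ℚ x) × (if rc then x ≤ℚ b else x <ℚ b)

NonEmptyI : Interval → Set
NonEmptyI I = ∃ λ x → x ∈I I

Intersect : Interval → Interval → Set
Intersect I J = ∃ λ x → (x ∈I I) × (x ∈I J)

IsIntervalRep : ∀ {n} → Graph n → (Fin n → Interval) → Set
IsIntervalRep G I =
  (∀ v → NonEmptyI (I v)) ×
  (∀ u v → u ≢ v → (Adj G u v ⇔ Intersect (I u) (I v)))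

IsIntervalGraph : ∀ {n} → Graph n → Set
IsIntervalGraph {n} G = Σ (Fin n → Interval) (IsIntervalRep G)

IsCoIntervalGraph : ∀ {n} → Graph n → Set
IsCoIntervalGraph G = IsIntervalGraph (complement G)

-- Cycles: a cycle of length 3 + m is an injective sequence
-- c 0, ..., c (2+m) of vertices with consecutive ones adjacent and
-- c (2+m) adjacent to c 0.

IsCycle : ∀ {n} → Graph n → (m : ℕ) → (Fin (suc (suc (suc m))) → Fin n) → Set
IsCycle G m c =
  Injective _≡_ _≡_ c ×
  (∀ (i : Fin (suc (suc m))) → Adj G (c (inject₁ i)) (c (suc i))) ×
  Adj G (c (fromℕ (suc (suc m)))) (c zero)

GirthAtLeast : ∀ {n} → ℕ → Graph n → Set
GirthAtLeast {n} g G =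
  ∀ (m : ℕ) (c : Fin (suc (suc (suc m))) → Fin n) → IsCycle G m c → g ≤ suc (suc (suc m))

IsForest : ∀ {n} → Graph n → Set
IsForest {n} G = ∀ (m : ℕ) (c : Fin (suc (suc (suc m))) → Fin n) → ¬ IsCycle G m c

data Walk {n} (G : Graph n) : Fin n → Fin n → ℕ → Set where
  here : ∀ {v} → Walk G v v 0
  step : ∀ {u w v ℓ} → Adj G u w → Walk G w v ℓ → Walk G u v (suc ℓ)

Connected : ∀ {n} → Graph n → Fin n → Fin n → Set
Connected G u v = ∃ λ ℓ → Walk G u v ℓ

DistAtMost : ∀ {n} → Graph n → Fin n → Fin n → ℕ → Set
DistAtMost G u v d = ∃ λ ℓ → ℓ ≤ d × Walk G u v ℓ

ComponentsDiamAtMost : ∀ {n} → ℕ → Graph n → Set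
ComponentsDiamAtMost d G = ∀ u v → Connected G u v → DistAtMost G u v d

IsConnectedGraph : ∀ {n} → Graph n → Set
IsConnectedGraph G = ∀ u v → Connected G u v

IsTree : ∀ {n} → Graph n → Set
IsTree G = IsConnectedGraph G × IsForest G

DiamAtMost : ∀ {n} → ℕ → Graph n → Set
DiamAtMost d G = ∀ u v → DistAtMost G u v d

{-# OPTIONS --safe #-}
-- In a co-interval representation the intervals of adjacent vertices are disjoint, so "lies to
-- the left of" orients G as an interval order: transitive and 2+2-free. 2+2-freeness makes G
-- 2K₂-free, which bounds the diameter of every component by 3. If the girth is at least 5,
-- transitivity forces the orientation to alternate along paths, and 2+2-freeness then puts a
-- chord into any five consecutive vertices of a cycle, closing a 4-cycle; so G is a forest.
--
-- Conversely, in a forest non-backtracking walks are shortest walks, so diameter at most 3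
-- forbids non-backtracking walks of length 4. Hence a tree of diameter at most 3 is a star or is
-- dominated by the middle edge pq of a path on four vertices; the points 0 and 3 for p and q,
-- [1,3] for the other neighbours of p and [0,2] for the remaining vertices (neighbours of q)
-- then represent the complement.
module Submission where

open import Defs
open import Agda.Builtin.FromNat using (fromNat)
open import Data.Bool using (Bool; true; false; not; if_then_else_)
open import Data.Bool.Properties using (¬-not; not-involutive) renaming (_≟_ to _≟ᵇ_)
open import Data.Empty using (⊥; ⊥-elim)
open import Data.Fin using (Fin; zero; suc; toℕ; inject₁; inject≤; fromℕ; _≟_)
open import Data.Fin.Properties using (toℕ<n; inject≤-injective; all?; ¬∀⟶∃¬)
open import Data.Nat using (ℕ; zero; suc; _+_; z≤n; s≤s) renaming (_≤_ to _≤ℕ_)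
open import Data.Nat.Literals using () renaming (number to ℕ-number)
open import Data.Nat.Properties using (1+n≰n; m≤n⇒m≤1+n; n≤1+n; m≤m+n; m≤n⇒m<n∨m≡n)
  renaming (≤-refl to ≤ℕ-refl; ≤-trans to ≤ℕ-trans; <⇒≤ to <ℕ⇒≤ℕ)
open import Data.Product using (Σ; ∃; ∃₂; _×_; _,_; proj₁; proj₂)
open import Data.Rational using (ℚ; _≤_; _<_)
open import Data.Rational.Literals using () renaming (number to ℚ-number)
open import Data.Rational.Properties
  using (≤-total; ≤-refl; ≤-trans; <-trans; ≤-<-trans; <-≤-trans; <⇒≤; ≮⇒≥; ≰⇒>; <-irrefl; <-asym; <-cmp;
         _≤?_; _<?_)
open import Data.Sum using (_⊎_; inj₁; inj₂; [_,_]′)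
  renaming (map to ⊎-map; map₂ to ⊎-map₂; swap to ⊎-swap)
open import Data.Unit using (⊤; tt)
open import Function using (_∘_; flip)
open import Function.Bundles using (_⇔_; mk⇔; Equivalence)
open import Function.Definitions using (Injective)
open import Function.Properties.Equivalence using () renaming (sym to ⇔-sym; trans to ⇔-trans)
open import Relation.Binary using (tri<; tri≈; tri>)
open import Relation.Binary.PropositionalEquality
  using (_≡_; _≢_; refl; cong; subst; trans; ≢-sym; module ≡-Reasoning) renaming (sym to ≡-sym)
open import Relation.Nullary using (¬_; Dec; yes; no; does; contradiction)
open import Relation.Nullary.Decidable using (dec-false; _⊎-dec_; _×-dec_; from-yes)
import Relation.Nullary.Decidable as Dec

-- Literals of ℚ carry a trivial ⊤ constraint, discharged by the instance tt.
instance
  _ = ℕ-number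
  _ = ℚ-number
  _ = tt

does≡true⇔ : ∀ {p} {P : Set p} (P? : Dec P) → (does P? ≡ true) ⇔ P
does≡true⇔ (yes p) = mk⇔ (λ _ → p) (λ _ → refl)
does≡true⇔ (no ¬p) = mk⇔ (λ ()) (λ p → contradiction p ¬p)

not≡true⇔≢true : ∀ b → (not b ≡ true) ⇔ (b ≢ true)
not≡true⇔≢true true  = mk⇔ (λ ()) (λ t≢t → contradiction refl t≢t)
not≡true⇔≢true false = mk⇔ (λ _ ()) (λ _ → refl)

private
  variable
    J K L M : Interval

Before : Interval → Interval → Set
Before J K = ∀ {x y} → x ∈I J → y ∈I K → x < y

∈I-convex : ∀ J {x y z} → x ∈I J → z ∈I J → x ≤ y → y ≤ z → y ∈I J
∈I-convex whole                     _       _       _   _   = tt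
∈I-convex (bounded _ _ true  true)  (l , _) (_ , r) x≤y y≤z = ≤-trans l x≤y , ≤-trans y≤z r
∈I-convex (bounded _ _ true  false) (l , _) (_ , r) x≤y y≤z = ≤-trans l x≤y , ≤-<-trans y≤z r
∈I-convex (bounded _ _ false true)  (l , _) (_ , r) x≤y y≤z = <-≤-trans l x≤y , ≤-trans y≤z r
∈I-convex (bounded _ _ false false) (l , _) (_ , r) x≤y y≤z = <-≤-trans l x≤y , ≤-<-trans y≤z r

disjoint⇒before : ∀ J K {x y} → x ∈I J → y ∈I K → x < y → ¬ Intersect J K → Before J K
disjoint⇒before J K {x} {y} x∈J y∈K x<y disjoint {x′} {y′} x′∈J y′∈K with x′ <? y′
... | yes x′<y′ = x′<y′
... | no x′≮y′ with y ≤? x′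
...   | yes y≤x′ = ⊥-elim (disjoint (y , ∈I-convex J x∈J x′∈J (<⇒≤ x<y) y≤x′ , y∈K))
...   | no y≰x′  =
  ⊥-elim (disjoint (x′ , x′∈J , ∈I-convex K y′∈K y∈K (≮⇒≥ x′≮y′) (<⇒≤ (≰⇒> y≰x′))))

disjoint⇒ordered : ∀ J K → NonEmptyI J → NonEmptyI K → ¬ Intersect J K → Before J K ⊎ Before K J
disjoint⇒ordered J K (x , x∈J) (y , y∈K) disjoint with <-cmp x y
... | tri< x<y _ _ = inj₁ (disjoint⇒before J K x∈J y∈K x<y disjoint)
... | tri≈ _ refl _ = ⊥-elim (disjoint (x , x∈J , y∈K))
... | tri> _ _ y<x =
  inj₂ (disjoint⇒before K J y∈K x∈J y<x (λ (z , z∈K , z∈J) → disjoint (z , z∈J , z∈K)))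

before⇒disjoint : Before J K → ¬ Intersect J K
before⇒disjoint J<K (x , x∈J , x∈K) = <-irrefl refl (J<K x∈J x∈K)

self-intersect : NonEmptyI J → Intersect J J
self-intersect (x , x∈J) = x , x∈J , x∈J

before-trans : NonEmptyI K → Before J K → Before K L → Before J L
before-trans (y , y∈K) J<K K<L x∈J z∈L = <-trans (J<K x∈J y∈K) (K<L y∈K z∈L)

before-crossing : Before J K → Before L M → Intersect J M → Intersect L K → ⊥
before-crossing J<K L<M (x , x∈J , x∈M) (y , y∈L , y∈K) = <-asym (J<K x∈J y∈K) (L<M y∈L x∈M)

⟦_,_⟧ : ℚ → ℚ → Interval
⟦ a , b ⟧ = bounded a b true true

closed-intersect⇔ : ∀ {a b c d} → a ≤ b → c ≤ d →
                    Intersect ⟦ a , b ⟧ ⟦ c , d ⟧ ⇔ (a ≤ d × c ≤ b)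
closed-intersect⇔ {a} {b} {c} {d} a≤b c≤d = mk⇔ to from
  where
  to : Intersect ⟦ a , b ⟧ ⟦ c , d ⟧ → a ≤ d × c ≤ b
  to (_ , (a≤x , x≤b) , (c≤x , x≤d)) = ≤-trans a≤x x≤d , ≤-trans c≤x x≤b

  from : a ≤ d × c ≤ b → Intersect ⟦ a , b ⟧ ⟦ c , d ⟧
  from (a≤d , c≤b) with ≤-total a c
  ... | inj₁ a≤c = c , (a≤c , c≤b) , (≤-refl , c≤d)
  ... | inj₂ c≤a = a , (≤-refl , a≤b) , (c≤a , a≤d)

closed-intersect? : ∀ {a b c d} → a ≤ b → c ≤ d → Dec (Intersect ⟦ a , b ⟧ ⟦ c , d ⟧)
closed-intersect? a≤b c≤d = Dec.map (⇔-sym (closed-intersect⇔ a≤b c≤d)) (_ ≤? _ ×-dec _ ≤? _)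

data Role : Set where
  hub₁ hub₂ leaf₁ leaf₂ : Role

lower upper : Role → ℚ
lower hub₁  = 0
lower hub₂  = 3
lower leaf₁ = 1
lower leaf₂ = 0
upper hub₁  = 0
upper hub₂  = 3
upper leaf₁ = 3
upper leaf₂ = 2

lower≤upper : ∀ r → lower r ≤ upper r
lower≤upper hub₁  = ≤-refl
lower≤upper hub₂  = ≤-refl
lower≤upper leaf₁ = from-yes (1 ≤? 3)
lower≤upper leaf₂ = from-yes (0 ≤? 2)

roleInterval : Role → Interval
roleInterval r = ⟦ lower r , upper r ⟧

roles-intersect? : ∀ r s → Dec (Intersect (roleInterval r) (roleInterval s))
roles-intersect? r s = closed-intersect? (lower≤upper r) (lower≤upper s)

roles-meet : Role → Role → Bool
roles-meet r s = does (roles-intersect? r s)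

private
  variable
    r s : Role

module _ {n : ℕ} (G : Graph n) where

  private
    variable
      ℓ k m g h : ℕ
      a b c d e u v w x : Fin n

  adjacent-sym : Adj G u v → Adj G v u
  adjacent-sym {u} {v} uv = trans (Graph.sym G v u) uv

  adjacent⇒≢ : Adj G u v → u ≢ v
  adjacent⇒≢ {u} uv refl = contradiction (trans (≡-sym uv) (irrefl G u)) λ ()

  adjacent? : (u v : Fin n) → Dec (Adj G u v)
  adjacent? u v = adj G u v ≟ᵇ true

  complement-adj : u ≢ v → adj (complement G) u v ≡ not (adj G u v)
  complement-adj {u = u} {v} u≢v =
    cong (λ b → if b then false else not (adj G u v)) (dec-false (u ≟ v) u≢v)

  complement-adjacent⇔ : u ≢ v → Adj (complement G) u v ⇔ (¬ Adj G u v)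
  complement-adjacent⇔ {u = u} {v} u≢v =
    subst (λ b → (b ≡ true) ⇔ (¬ Adj G u v)) (≡-sym (complement-adj u≢v)) (not≡true⇔≢true (adj G u v))

  record IntervalOrientation : Set₁ where
    field
      _≺_                 : Fin n → Fin n → Set
      adjacent⇒comparable : ∀ {u v} → Adj G u v → u ≺ v ⊎ v ≺ u
      ≺⇒adjacent          : ∀ {u v} → u ≺ v → Adj G u v
      ≺-trans             : ∀ {u v w} → u ≺ v → v ≺ w → u ≺ w
      ≺-2+2               : ∀ {a b c d} → a ≺ b → c ≺ d → a ≺ d ⊎ c ≺ b

  reverse : IntervalOrientation → IntervalOrientation
  reverse O = record
    { _≺_                 = flip _≺_
    ; adjacent⇒comparable = ⊎-swap ∘ adjacent⇒comparable
    ; ≺⇒adjacent          = adjacent-sym ∘ ≺⇒adjacent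
    ; ≺-trans             = flip ≺-trans
    ; ≺-2+2               = λ b≺a d≺c → ⊎-swap (≺-2+2 b≺a d≺c)
    }
    where open IntervalOrientation O

  module _ {I : Fin n → Interval} (rep : IsIntervalRep (complement G) I) where

    private
      nonEmpty : ∀ v → NonEmptyI (I v)
      nonEmpty = proj₁ rep

      nonadjacent⇔intersect : u ≢ v → (¬ Adj G u v) ⇔ Intersect (I u) (I v)
      nonadjacent⇔intersect u≢v = ⇔-trans (⇔-sym (complement-adjacent⇔ u≢v)) (proj₂ rep _ _ u≢v)

      adjacent⇒disjoint : Adj G u v → ¬ Intersect (I u) (I v)
      adjacent⇒disjoint uv u∩v = Equivalence.from (nonadjacent⇔intersect (adjacent⇒≢ uv)) u∩v uv

      intersect-unless-adjacent : ¬ Adj G u v → Intersect (I u) (I v)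
      intersect-unless-adjacent {u} {v} ¬uv with u ≟ v
      ... | yes refl = self-intersect (nonEmpty u)
      ... | no u≢v   = Equivalence.to (nonadjacent⇔intersect u≢v) ¬uv

      ordered⊎intersect : ∀ u v → Before (I u) (I v) ⊎ Before (I v) (I u) ⊎ Intersect (I u) (I v)
      ordered⊎intersect u v with adjacent? u v
      ... | yes uv = ⊎-map₂ inj₁ (disjoint⇒ordered _ _ (nonEmpty u) (nonEmpty v) (adjacent⇒disjoint uv))
      ... | no ¬uv = inj₂ (inj₂ (intersect-unless-adjacent ¬uv))

      before⇒adjacent : Before (I u) (I v) → Adj G u v
      before⇒adjacent {u} {v} u<v with adjacent? u v
      ... | yes uv = uv
      ... | no ¬uv = ⊥-elim (before⇒disjoint u<v (intersect-unless-adjacent ¬uv))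

      before-2+2 : Before (I a) (I b) → Before (I c) (I d) → Before (I a) (I d) ⊎ Before (I c) (I b)
      before-2+2 {a} {b} {c} {d} a<b c<d with ordered⊎intersect a d | ordered⊎intersect c b
      ... | inj₁ a<d        | _               = inj₁ a<d
      ... | inj₂ (inj₁ d<a) | _               =
        inj₂ (before-trans (nonEmpty a) (before-trans (nonEmpty d) c<d d<a) a<b)
      ... | _               | inj₁ c<b        = inj₂ c<b
      ... | _               | inj₂ (inj₁ b<c) =
        inj₁ (before-trans (nonEmpty c) (before-trans (nonEmpty b) a<b b<c) c<d)
      ... | inj₂ (inj₂ a∩d) | inj₂ (inj₂ c∩b) = ⊥-elim (before-crossing a<b c<d a∩d c∩b)

    coInterval⇒intervalOrientation : IntervalOrientation
    coInterval⇒intervalOrientation = record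
      { _≺_                 = λ u v → Before (I u) (I v)
      ; adjacent⇒comparable = λ uv → disjoint⇒ordered _ _ (nonEmpty _) (nonEmpty _) (adjacent⇒disjoint uv)
      ; ≺⇒adjacent          = before⇒adjacent
      ; ≺-trans             = before-trans (nonEmpty _)
      ; ≺-2+2               = before-2+2
      }

  TwoK₂Free : Set
  TwoK₂Free = ∀ {a b c d} → Adj G a b → Adj G c d → Adj G a c ⊎ Adj G a d ⊎ Adj G b c ⊎ Adj G b d

  module _ (O : IntervalOrientation) where

    open IntervalOrientation O

    private
      linked : a ≺ b → c ≺ d → Adj G a d ⊎ Adj G b c
      linked a≺b c≺d = ⊎-map ≺⇒adjacent (adjacent-sym ∘ ≺⇒adjacent) (≺-2+2 a≺b c≺d)

    intervalOrientation⇒twoK₂Free : TwoK₂Free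
    intervalOrientation⇒twoK₂Free ab cd with adjacent⇒comparable ab | adjacent⇒comparable cd
    ... | inj₁ a≺b | inj₁ c≺d = [ inj₂ ∘ inj₁ , inj₂ ∘ inj₂ ∘ inj₁ ]′ (linked a≺b c≺d)
    ... | inj₁ a≺b | inj₂ d≺c = [ inj₁ , inj₂ ∘ inj₂ ∘ inj₂ ]′ (linked a≺b d≺c)
    ... | inj₂ b≺a | inj₁ c≺d = [ inj₂ ∘ inj₂ ∘ inj₂ , inj₁ ]′ (linked b≺a c≺d)
    ... | inj₂ b≺a | inj₂ d≺c = [ inj₂ ∘ inj₂ ∘ inj₁ , inj₂ ∘ inj₁ ]′ (linked b≺a d≺c)

  module _ (free : TwoK₂Free) where

    twoK₂Free-edgeEnds-dist≤3 : Adj G u w → Adj G x v → DistAtMost G u v 3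
    twoK₂Free-edgeEnds-dist≤3 uw xv with free uw xv
    ... | inj₁ ux               = 2 , s≤s (s≤s z≤n) , step ux (step xv here)
    ... | inj₂ (inj₁ uv)        = 1 , s≤s z≤n , step uv here
    ... | inj₂ (inj₂ (inj₁ wx)) = 3 , ≤ℕ-refl , step uw (step wx (step xv here))
    ... | inj₂ (inj₂ (inj₂ wv)) = 2 , s≤s (s≤s z≤n) , step uw (step wv here)

    twoK₂Free-dist≤3-cons : Adj G u w → DistAtMost G w v 3 → DistAtMost G u v 3
    twoK₂Free-dist≤3-cons uw (ℓ , ℓ≤3 , W) with m≤n⇒m<n∨m≡n ℓ≤3
    ... | inj₁ ℓ<3 = suc ℓ , ℓ<3 , step uw W
    ... | inj₂ refl with W
    ...   | step _ (step _ (step xv here)) = twoK₂Free-edgeEnds-dist≤3 uw xv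

    twoK₂Free-walk⇒dist≤3 : Walk G u v ℓ → DistAtMost G u v 3
    twoK₂Free-walk⇒dist≤3 here        = 0 , z≤n , here
    twoK₂Free-walk⇒dist≤3 (step uw W) = twoK₂Free-dist≤3-cons uw (twoK₂Free-walk⇒dist≤3 W)

    twoK₂Free⇒componentsDiam≤3 : ComponentsDiamAtMost 3 G
    twoK₂Free⇒componentsDiam≤3 _ _ (_ , W) = twoK₂Free-walk⇒dist≤3 W

  girthAtLeast-weaken : g ≤ℕ h → GirthAtLeast h G → GirthAtLeast g G
  girthAtLeast-weaken g≤h girth m c cycle = ≤ℕ-trans g≤h (girth m c cycle)

  forest⇒girthAtLeast : IsForest G → GirthAtLeast g G
  forest⇒girthAtLeast forest m c cycle = ⊥-elim (forest m c cycle)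

  vertices : Walk G u v ℓ → Fin (suc ℓ) → Fin n
  vertices {u = u} _ zero    = u
  vertices (step _ W) (suc i) = vertices W i

  vertices-last : (W : Walk G u v ℓ) → vertices W (fromℕ ℓ) ≡ v
  vertices-last here       = refl
  vertices-last (step _ W) = vertices-last W

  vertices-adjacent : (W : Walk G u v ℓ) (i : Fin ℓ) → Adj G (vertices W (inject₁ i)) (vertices W (suc i))
  vertices-adjacent (step uw _) zero    = uw
  vertices-adjacent (step _ W)  (suc i) = vertices-adjacent W i

  take : (W : Walk G u v ℓ) (i : Fin (suc ℓ)) → Walk G u (vertices W i) (toℕ i)
  take _          zero    = here
  take (step uw W) (suc i) = step uw (take W i)

  vertices-take : (W : Walk G u v ℓ) (i : Fin (suc ℓ)) (j : Fin (suc (toℕ i))) →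
                  vertices (take W i) j ≡ vertices W (inject≤ j (toℕ<n i))
  vertices-take _          zero    zero    = refl
  vertices-take (step _ W) (suc i) zero    = refl
  vertices-take (step _ W) (suc i) (suc j) = vertices-take W i j

  take-injective : (W : Walk G u v ℓ) (i : Fin (suc ℓ)) →
                   Injective _≡_ _≡_ (vertices W) → Injective _≡_ _≡_ (vertices (take W i))
  take-injective W i injective {j} {k} eq = inject≤-injective _ _ j k (injective (begin
    vertices W (inject≤ j _) ≡⟨ vertices-take W i j ⟨
    vertices (take W i) j    ≡⟨ eq ⟩
    vertices (take W i) k    ≡⟨ vertices-take W i k ⟩
    vertices W (inject≤ k _) ∎))
    where open ≡-Reasoning

  path-closing-cycle : (P : Walk G w u (suc (suc m))) → Injective _≡_ _≡_ (vertices P) →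
                       Adj G u w → IsCycle G m (vertices P)
  path-closing-cycle P injective uw =
    injective , vertices-adjacent P , subst (λ x → Adj G x _) (≡-sym (vertices-last P)) uw

  NonBacktracking : Walk G u v ℓ → Set
  NonBacktracking here                                 = ⊤
  NonBacktracking (step _ here)                        = ⊤
  NonBacktracking (step {u = u} _ W@(step {w = x} _ _)) = u ≢ x × NonBacktracking W

  nonBacktracking-tail : {uw : Adj G u w} (W : Walk G w v ℓ) → NonBacktracking (step uw W) → NonBacktracking W
  nonBacktracking-tail here       _        = tt
  nonBacktracking-tail (step _ _) (_ , nb) = nb

  nonBacktracking-shortening : Walk G u v ℓ → ∃ λ k → k ≤ℕ ℓ × Σ (Walk G u v k) NonBacktracking
  nonBacktracking-shortening here = 0 , z≤n , here , tt
  nonBacktracking-shortening {u = u} (step uw W) with nonBacktracking-shortening W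
  ... | 0 , _ , here , _ = 1 , s≤s z≤n , step uw here , tt
  ... | suc k , k<ℓ , step {w = x} wx W′ , nb with u ≟ x
  ...   | yes refl = k , m≤n⇒m≤1+n (<ℕ⇒≤ℕ k<ℓ) , W′ , nonBacktracking-tail W′ nb
  ...   | no u≢x   = suc (suc k) , s≤s k<ℓ , step uw (step wx W′) , u≢x , nb

  -- A return of W to u at position i closes take W i into a cycle of length i + 1 < girth.
  nonBacktracking-head-fresh : GirthAtLeast (suc (suc ℓ)) G → (uw : Adj G u w) (W : Walk G w v ℓ) →
                               NonBacktracking (step uw W) → Injective _≡_ _≡_ (vertices W) →
                               ∀ i → vertices W i ≢ u
  nonBacktracking-head-fresh _ uw _ _ _ zero w≡u = adjacent⇒≢ uw (≡-sym w≡u)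
  nonBacktracking-head-fresh _ _ (step _ _) (u≢x , _) _ (suc zero) x≡u = u≢x (≡-sym x≡u)
  nonBacktracking-head-fresh girth uw W _ injective i@(suc (suc i′)) wᵢ≡u =
    1+n≰n (≤ℕ-trans (girth _ _ cycle) (toℕ<n i))
    where
    cycle : IsCycle G (toℕ i′) (vertices (take W i))
    cycle = path-closing-cycle (take W i) (take-injective W i injective)
                               (subst (λ x → Adj G x _) (≡-sym wᵢ≡u) uw)

  nonBacktracking⇒injective : GirthAtLeast (suc ℓ) G → (W : Walk G u v ℓ) → NonBacktracking W →
                              Injective _≡_ _≡_ (vertices W)
  nonBacktracking⇒injective _ here _ {zero} {zero} _ = refl
  nonBacktracking⇒injective girth (step {u = u} uw W) nb = injective
    where
    injective-W : Injective _≡_ _≡_ (vertices W)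
    injective-W = nonBacktracking⇒injective (girthAtLeast-weaken (n≤1+n _) girth) W (nonBacktracking-tail W nb)
    fresh : ∀ i → vertices W i ≢ u
    fresh = nonBacktracking-head-fresh girth uw W nb injective-W
    injective : Injective _≡_ _≡_ (vertices (step uw W))
    injective {zero}  {zero}  _     = refl
    injective {zero}  {suc j} u≡wⱼ  = ⊥-elim (fresh j (≡-sym u≡wⱼ))
    injective {suc i} {zero}  wᵢ≡u  = ⊥-elim (fresh i wᵢ≡u)
    injective {suc i} {suc j} wᵢ≡wⱼ = cong suc (injective-W wᵢ≡wⱼ)

  ¬closed-nonBacktracking : GirthAtLeast (suc (suc ℓ)) G → (W : Walk G u u (suc ℓ)) → ¬ NonBacktracking W
  ¬closed-nonBacktracking girth W nb
    with () ← nonBacktracking⇒injective girth W nb {zero} {fromℕ _} (≡-sym (vertices-last W))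

  TriangleFree : Set
  TriangleFree = ∀ {a b c} → Adj G a b → Adj G b c → Adj G c a → ⊥

  SquareFree : Set
  SquareFree = ∀ {a b c d} → Adj G a b → Adj G b c → Adj G c d → Adj G d a → a ≢ c → b ≢ d → ⊥

  girth≥4⇒triangleFree : GirthAtLeast 4 G → TriangleFree
  girth≥4⇒triangleFree girth ab bc ca =
    ¬closed-nonBacktracking girth (step ab (step bc (step ca here)))
                            (≢-sym (adjacent⇒≢ ca) , ≢-sym (adjacent⇒≢ ab) , tt)

  girth≥5⇒squareFree : GirthAtLeast 5 G → SquareFree
  girth≥5⇒squareFree girth ab bc cd da a≢c b≢d =
    ¬closed-nonBacktracking girth (step ab (step bc (step cd (step da here)))) (a≢c , b≢d , ≢-sym a≢c , tt)

  -- Induction on the walk W: prepending the reverse of W's first edge to P keeps P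
  -- non-backtracking unless it cancels P's first edge.
  nonBacktracking-shortest : IsForest G → (P : Walk G u v k) → NonBacktracking P → Walk G u v ℓ → k ≤ℕ ℓ
  nonBacktracking-shortest _ here _ _ = z≤n
  nonBacktracking-shortest forest P@(step _ _) nb here =
    ⊥-elim (¬closed-nonBacktracking (forest⇒girthAtLeast forest) P nb)
  nonBacktracking-shortest forest P@(step {w = x} _ P′) nb (step {w = w} uw W) with x ≟ w
  ... | yes refl = s≤s (nonBacktracking-shortest forest P′ (nonBacktracking-tail P′ nb) W)
  ... | no x≢w   =
    m≤n⇒m≤1+n (<ℕ⇒≤ℕ (nonBacktracking-shortest forest (step (adjacent-sym uw) P) (≢-sym x≢w , nb) W))

  module _ (O : IntervalOrientation) (triangleFree : TriangleFree) where

    open IntervalOrientation O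

    ≺-no-chain : u ≺ v → v ≺ w → ⊥
    ≺-no-chain u≺v v≺w =
      triangleFree (≺⇒adjacent u≺v) (≺⇒adjacent v≺w) (adjacent-sym (≺⇒adjacent (≺-trans u≺v v≺w)))

    ≺-maximal : u ≺ v → Adj G v w → w ≺ v
    ≺-maximal u≺v vw =
      [ (λ v≺w → ⊥-elim (≺-no-chain u≺v v≺w)) , (λ w≺v → w≺v) ]′ (adjacent⇒comparable vw)

    ≺-minimal : v ≺ u → Adj G v w → v ≺ w
    ≺-minimal v≺u vw =
      [ (λ v≺w → v≺w) , (λ w≺v → ⊥-elim (≺-no-chain w≺v v≺u)) ]′ (adjacent⇒comparable vw)

    ≺-P₅-chord : a ≺ b → Adj G b c → Adj G c d → Adj G d e → Adj G a d ⊎ Adj G b e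
    ≺-P₅-chord a≺b bc cd de =
      ⊎-map ≺⇒adjacent (adjacent-sym ∘ ≺⇒adjacent) (≺-2+2 a≺b e≺d)
      where
      c≺b = ≺-maximal a≺b bc
      c≺d = ≺-minimal c≺b cd
      e≺d = ≺-maximal c≺d de

  P₅-chord : IntervalOrientation → TriangleFree →
             Adj G a b → Adj G b c → Adj G c d → Adj G d e → Adj G a d ⊎ Adj G b e
  P₅-chord O triangleFree ab bc cd de with IntervalOrientation.adjacent⇒comparable O ab
  ... | inj₁ a≺b = ≺-P₅-chord O triangleFree a≺b bc cd de
  ... | inj₂ b≺a = ≺-P₅-chord (reverse O) triangleFree b≺a bc cd de

  intervalOrientation-girth≥5⇒¬P₅ : IntervalOrientation → GirthAtLeast 5 G →
                                    Adj G a b → Adj G b c → Adj G c d → Adj G d e →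
                                    a ≢ c → b ≢ d → c ≢ e → ⊥
  intervalOrientation-girth≥5⇒¬P₅ O girth ab bc cd de a≢c b≢d c≢e
    with P₅-chord O (girth≥4⇒triangleFree (girthAtLeast-weaken (n≤1+n _) girth)) ab bc cd de
  ... | inj₁ ad = girth≥5⇒squareFree girth ab bc cd (adjacent-sym ad) a≢c b≢d
  ... | inj₂ be = girth≥5⇒squareFree girth bc cd de (adjacent-sym be) b≢d c≢e

  intervalOrientation-girth≥5⇒forest : IntervalOrientation → GirthAtLeast 5 G → IsForest G
  intervalOrientation-girth≥5⇒forest O girth m c cycle with girth m c cycle
  intervalOrientation-girth≥5⇒forest O girth zero          c _ | s≤s (s≤s (s≤s ()))
  intervalOrientation-girth≥5⇒forest O girth (suc zero)    c _ | s≤s (s≤s (s≤s (s≤s ())))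
  intervalOrientation-girth≥5⇒forest O girth (suc (suc m)) c (injective , edge , _) | _ =
    intervalOrientation-girth≥5⇒¬P₅ O girth
      (edge zero) (edge (suc zero)) (edge (suc (suc zero))) (edge (suc (suc (suc zero))))
      ((λ ()) ∘ injective) ((λ ()) ∘ injective) ((λ ()) ∘ injective)

  Dominates : Fin n → Set
  Dominates c = ∀ z → z ≡ c ⊎ Adj G c z

  IsDoubleStar : Fin n → Fin n → Set
  IsDoubleStar p q = (p ≡ q ⊎ Adj G p q) × (∀ z → z ≡ p ⊎ z ≡ q ⊎ Adj G p z ⊎ Adj G q z)

  dominated-by? : ∀ c z → Dec (z ≡ c ⊎ Adj G c z)
  dominated-by? c z = z ≟ c ⊎-dec adjacent? c z

  dominates⇒doubleStar : Dominates c → IsDoubleStar c c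
  dominates⇒doubleStar dominates = inj₁ refl , λ z → [ inj₁ , inj₂ ∘ inj₂ ∘ inj₁ ]′ (dominates z)

  module _ (connected : IsConnectedGraph G) where

    near⊎nonBacktracking≥2 : ∀ c z →
                             z ≡ c ⊎ Adj G c z ⊎ ∃ λ k → Σ (Walk G c z (suc (suc k))) NonBacktracking
    near⊎nonBacktracking≥2 c z with nonBacktracking-shortening (proj₂ (connected c z))
    ... | _ , _ , here , _                  = inj₁ refl
    ... | _ , _ , step cz here , _          = inj₂ (inj₁ cz)
    ... | _ , _ , P@(step _ (step _ _)) , nb = inj₂ (inj₂ (_ , P , nb))

    dominates⊎P₃ : ∀ c → Dominates c ⊎ ∃₂ λ s t → Adj G c s × Adj G s t × c ≢ t
    dominates⊎P₃ c with all? (dominated-by? c)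
    ... | yes dominates = inj₁ dominates
    ... | no ¬dominates with ¬∀⟶∃¬ _ _ (dominated-by? c) ¬dominates
    ...   | z , z-far with near⊎nonBacktracking≥2 c z
    ...     | inj₁ z≡c                                   = ⊥-elim (z-far (inj₁ z≡c))
    ...     | inj₂ (inj₁ cz)                             = ⊥-elim (z-far (inj₂ cz))
    ...     | inj₂ (inj₂ (_ , step cs (step st _) , c≢t , _)) = inj₂ (_ , _ , cs , st , c≢t)

  module _ (forest : IsForest G) (diam : DiamAtMost 3 G) where

    private
      connected : IsConnectedGraph G
      connected u v = let (ℓ , _ , W) = diam u v in ℓ , W

    ¬long-nonBacktracking : (P : Walk G u v (4 + m)) → ¬ NonBacktracking P
    ¬long-nonBacktracking {u = u} {v} {m} P nb =
      let (ℓ , ℓ≤3 , W) = diam u v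
      in 1+n≰n (≤ℕ-trans (m≤m+n 4 m) (≤ℕ-trans (nonBacktracking-shortest forest P nb W) ℓ≤3))

    P₄-centre-doubleStar : Adj G a c → Adj G c d → Adj G d b → a ≢ d → c ≢ b → IsDoubleStar c d
    P₄-centre-doubleStar {a} {c} {d} {b} ac cd db a≢d c≢b = inj₂ cd , covered
      where
      -- Unless P is c d v, prepending b d (if P avoids d) or a (if P starts c d) makes it a
      -- non-backtracking walk of length at least 4.
      reaches-d : (P : Walk G c v (suc (suc k))) → NonBacktracking P → Adj G d v
      reaches-d (step {w = t} ct (step ts W)) (c≢s , nb) with t ≟ d
      ... | no t≢d = ⊥-elim (¬long-nonBacktracking
                               (step (adjacent-sym db) (step (adjacent-sym cd) (step ct (step ts W))))
                               (≢-sym c≢b , ≢-sym t≢d , c≢s , nb))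
      reaches-d (step _ (step ds here)) _ | yes refl = ds
      reaches-d (step cd′ (step ds (step su W))) (c≢s , nb) | yes refl =
        ⊥-elim (¬long-nonBacktracking (step ac (step cd′ (step ds (step su W)))) (a≢d , c≢s , nb))

      covered : ∀ z → z ≡ c ⊎ z ≡ d ⊎ Adj G c z ⊎ Adj G d z
      covered z with near⊎nonBacktracking≥2 connected c z
      ... | inj₁ z≡c               = inj₁ z≡c
      ... | inj₂ (inj₁ cz)         = inj₂ (inj₂ (inj₁ cz))
      ... | inj₂ (inj₂ (_ , P , nb)) = inj₂ (inj₂ (inj₂ (reaches-d P nb)))

    P₃-centre-doubleStar : Adj G a c → Adj G c b → a ≢ b → ∃₂ IsDoubleStar
    P₃-centre-doubleStar {a} {c} {b} ac cb a≢b with dominates⊎P₃ connected c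
    ... | inj₁ dominates = c , c , dominates⇒doubleStar dominates
    ... | inj₂ (s , t , cs , st , c≢t) with s ≟ a
    ...   | no s≢a   = c , s , P₄-centre-doubleStar ac cs st (≢-sym s≢a) c≢t
    ...   | yes refl = c , s , P₄-centre-doubleStar (adjacent-sym cb) cs st (≢-sym a≢b) c≢t

    doubleStar-centres : Fin n → ∃₂ IsDoubleStar
    doubleStar-centres a with dominates⊎P₃ connected a
    ... | inj₁ dominates                 = a , a , dominates⇒doubleStar dominates
    ... | inj₂ (s , t , as , st , a≢t) = P₃-centre-doubleStar as st a≢t

  module _ {p q : Fin n} (doubleStar : IsDoubleStar p q) (triangleFree : TriangleFree) (squareFree : SquareFree) where

    private
      hubs-adjacent : p ≢ q → Adj G p q
      hubs-adjacent p≢q = [ (λ p≡q → ⊥-elim (p≢q p≡q)) , (λ pq → pq) ]′ (proj₁ doubleStar)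

      hubs-distinct : Adj G q v → ¬ Adj G p v → p ≢ q
      hubs-distinct qv ¬pv refl = ¬pv qv

    data RoleOf (v : Fin n) : Role → Set where
      is-hub₁  : v ≡ p → RoleOf v hub₁
      is-hub₂  : v ≡ q → v ≢ p → RoleOf v hub₂
      is-leaf₁ : Adj G p v → v ≢ q → RoleOf v leaf₁
      is-leaf₂ : Adj G q v → ¬ Adj G p v → v ≢ p → RoleOf v leaf₂

    classify : ∀ v → ∃ (RoleOf v)
    classify v with v ≟ p | v ≟ q | adjacent? p v
    ... | yes v≡p | _       | _      = _ , is-hub₁ v≡p
    ... | no v≢p  | yes v≡q | _      = _ , is-hub₂ v≡q v≢p
    ... | no _    | no v≢q  | yes pv = _ , is-leaf₁ pv v≢q
    ... | no v≢p  | no v≢q  | no ¬pv with proj₂ doubleStar v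
    ...   | inj₁ v≡p              = ⊥-elim (v≢p v≡p)
    ...   | inj₂ (inj₁ v≡q)       = ⊥-elim (v≢q v≡q)
    ...   | inj₂ (inj₂ (inj₁ pv)) = ⊥-elim (¬pv pv)
    ...   | inj₂ (inj₂ (inj₂ qv)) = _ , is-leaf₂ qv ¬pv v≢p

    -- On concrete roles the right-hand side evaluates, e.g. to true for (hub₁, leaf₁) since {0} and
    -- [1,3] are disjoint.
    adjacency-by-role : RoleOf u r → RoleOf v s → u ≢ v → adj G u v ≡ not (roles-meet r s)
    adjacency-by-role (is-hub₁ refl)       (is-hub₁ refl)        u≢v = ⊥-elim (u≢v refl)
    adjacency-by-role (is-hub₁ refl)       (is-hub₂ refl q≢p)    _   = hubs-adjacent (≢-sym q≢p)
    adjacency-by-role (is-hub₁ refl)       (is-leaf₁ pv _)       _   = pv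
    adjacency-by-role (is-hub₁ refl)       (is-leaf₂ _ ¬pv _)    _   = ¬-not ¬pv
    adjacency-by-role (is-hub₂ refl q≢p)   (is-hub₁ refl)        _   = adjacent-sym (hubs-adjacent (≢-sym q≢p))
    adjacency-by-role (is-hub₂ refl _)     (is-hub₂ refl _)      u≢v = ⊥-elim (u≢v refl)
    adjacency-by-role (is-hub₂ refl q≢p)   (is-leaf₁ pv _)       _   =
      ¬-not λ qv → triangleFree (hubs-adjacent (≢-sym q≢p)) qv (adjacent-sym pv)
    adjacency-by-role (is-hub₂ refl _)     (is-leaf₂ qv _ _)     _   = qv
    adjacency-by-role (is-leaf₁ pu _)      (is-hub₁ refl)        _   = adjacent-sym pu
    adjacency-by-role (is-leaf₁ pu _)      (is-hub₂ refl q≢p)    _   =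
      ¬-not λ uq → triangleFree (hubs-adjacent (≢-sym q≢p)) (adjacent-sym uq) (adjacent-sym pu)
    adjacency-by-role (is-leaf₁ pu _)      (is-leaf₁ pv _)       _   =
      ¬-not λ uv → triangleFree pu uv (adjacent-sym pv)
    adjacency-by-role (is-leaf₁ pu u≢q)    (is-leaf₂ qv ¬pv v≢p) _   =
      ¬-not λ uv → squareFree pu uv (adjacent-sym qv) (adjacent-sym (hubs-adjacent (hubs-distinct qv ¬pv)))
                              (≢-sym v≢p) u≢q
    adjacency-by-role (is-leaf₂ _ ¬pu _)   (is-hub₁ refl)        _   = ¬-not (¬pu ∘ adjacent-sym)
    adjacency-by-role (is-leaf₂ qu _ _)    (is-hub₂ refl _)      _   = adjacent-sym qu
    adjacency-by-role (is-leaf₂ qu ¬pu u≢p) (is-leaf₁ pv v≢q)    _   =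
      ¬-not λ uv → squareFree pv (adjacent-sym uv) (adjacent-sym qu) (adjacent-sym (hubs-adjacent (hubs-distinct qu ¬pu)))
                              (≢-sym u≢p) v≢q
    adjacency-by-role (is-leaf₂ qu _ _)    (is-leaf₂ qv _ _)     _   =
      ¬-not λ uv → triangleFree qu uv (adjacent-sym qv)

    doubleStar⇒coInterval : IsCoIntervalGraph G
    doubleStar⇒coInterval = I , (λ v → lower (role v) , ≤-refl , lower≤upper (role v)) , representation
      where
      role : Fin n → Role
      role v = proj₁ (classify v)

      view : ∀ v → RoleOf v (role v)
      view v = proj₂ (classify v)

      I : Fin n → Interval
      I = roleInterval ∘ role

      complement-adj≡meet : u ≢ v → adj (complement G) u v ≡ roles-meet (role u) (role v)
      complement-adj≡meet {u} {v} u≢v = begin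
        adj (complement G) u v                   ≡⟨ complement-adj u≢v ⟩
        not (adj G u v)                          ≡⟨ cong not (adjacency-by-role (view u) (view v) u≢v) ⟩
        not (not (roles-meet (role u) (role v))) ≡⟨ not-involutive _ ⟩
        roles-meet (role u) (role v)             ∎
        where open ≡-Reasoning

      representation : ∀ u v → u ≢ v → Adj (complement G) u v ⇔ Intersect (I u) (I v)
      representation u v u≢v =
        subst (λ b → (b ≡ true) ⇔ Intersect (I u) (I v)) (≡-sym (complement-adj≡meet u≢v))
              (does≡true⇔ (roles-intersect? (role u) (role v)))

coInterval-girth≥5⇒forest-diam≤3 : ∀ {n} (G : Graph n) → IsCoIntervalGraph G → GirthAtLeast 5 G →
                                    IsForest G × ComponentsDiamAtMost 3 G
coInterval-girth≥5⇒forest-diam≤3 G (_ , rep) girth =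
  intervalOrientation-girth≥5⇒forest G O girth ,
  twoK₂Free⇒componentsDiam≤3 G (intervalOrientation⇒twoK₂Free G O)
  where
  O : IntervalOrientation G
  O = coInterval⇒intervalOrientation G rep

tree-diam≤3⇒coInterval : ∀ {n} (G : Graph n) → IsTree G → DiamAtMost 3 G → IsCoIntervalGraph G
tree-diam≤3⇒coInterval {zero}  G _ _ = (λ ()) , (λ ()) , (λ ())
tree-diam≤3⇒coInterval {suc _} G (_ , forest) diam =
  let (_ , _ , isDoubleStar) = doubleStar-centres G forest diam zero
  in doubleStar⇒coInterval G isDoubleStar (girth≥4⇒triangleFree G girth) (girth≥5⇒squareFree G girth)
  where
  girth : ∀ {g} → GirthAtLeast g G
  girth = forest⇒girthAtLeast G forest

mainTheorem15 : ((n : ℕ) (G : Graph n) → IsCoIntervalGraph G → GirthAtLeast 5 G →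
    IsForest G × ComponentsDiamAtMost 3 G)
    ×
    ((n : ℕ) (G : Graph n) → IsTree G → DiamAtMost 3 G → IsCoIntervalGraph G)
mainTheorem15 = (λ _ → coInterval-girth≥5⇒forest-diam≤3) , (λ _ → tree-diam≤3⇒coInterval)
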